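{- Let $F:2^N\to\mathbb{R}$ be an $\varepsilon$-approximately submodular function ($0\le\varepsilon<1$) which approximates a monotone submodular function $f$ with curvature $c<1$. Let $F_a(S)=\sum_{e\in S}F(\{e\})$. Then for all $S\subseteq N$, $$\frac{1-\varepsilon}{1+\varepsilon}F(S)\le F_a(S)\le\frac{1}{1-c}\cdot\frac{1+\varepsilon}{1-\varepsilon}F(S).$$
   Context: Submodular functions are normalized ($f(\emptyset)=0$). $F$ approximates $f$ if $(1-\varepsilon)f(S)\le F(S)\le(1+\varepsilon)f(S)$ for all $S\subseteq N$. The curvature of $f$ is $c=1-\min_{a\in N}\frac{f_{N\setminus\{a\}}(a)}{f(a)}$, where $f_S(a)=f(S\cup\{a\})-f(S)$. -}

module Defs where

open import Level using (Level; suc)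
open import Data.Bool using (true; false)
open import Data.Fin using (Fin)
open import Data.Fin.Subset using (Subset; ⁅_⁆; ⊤; ⊥; _∪_; _∩_; _⊆_; _-_)
open import Data.Nat using (ℕ)
open import Data.Vec using (_∷_; [])
open import Data.Product using (_×_; ∃)
open import Relation.Nullary using (¬_)
open import Relation.Binary.PropositionalEquality using (_≡_)
open import Relation.Binary.Structures using (IsTotalOrder)
open import Algebra.Structures using (IsCommutativeRing)

-- An ordered field (the real numbers are an instance).  Inverse is total;
-- the value of 0⁻¹ is unconstrained.
record OrderedField (c : Level) : Set (suc c) where
  infixl 6 _+_
  infixl 7 _*_
  infix 8 -_
  infix 9 _⁻¹
  infix 4 _≤_
  field
    Carrier : Set c
    _+_ _*_ : Carrier → Carrier → Carrier
    -_ _⁻¹  : Carrier → Carrier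
    0# 1#   : Carrier
    _≤_     : Carrier → Carrier → Set c
    isCommutativeRing : IsCommutativeRing _≡_ _+_ _*_ -_ 0# 1#
    0≢1      : ¬ (0# ≡ 1#)
    inverseʳ : ∀ x → ¬ (x ≡ 0#) → x * x ⁻¹ ≡ 1#
    isTotalOrder : IsTotalOrder _≡_ _≤_
    +-monoˡ-≤ : ∀ {x y} z → x ≤ y → x + z ≤ y + z
    *-nonneg  : ∀ {x y} → 0# ≤ x → 0# ≤ y → 0# ≤ x * y

  infixl 6 _−_
  _−_ : Carrier → Carrier → Carrier
  x − y = x + - y

  infixl 7 _÷_
  _÷_ : Carrier → Carrier → Carrier
  x ÷ y = x * y ⁻¹

  infix 4 _<_
  _<_ : Carrier → Carrier → Set c
  x < y = x ≤ y × ¬ (x ≡ y)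

module _ {c : Level} (K : OrderedField c) where
  open OrderedField K

  Normalized : ∀ {n} → (Subset n → Carrier) → Set c
  Normalized f = f ⊥ ≡ 0#

  Monotone : ∀ {n} → (Subset n → Carrier) → Set c
  Monotone f = ∀ S T → S ⊆ T → f S ≤ f T

  Submodular : ∀ {n} → (Subset n → Carrier) → Set c
  Submodular f = ∀ S T → f (S ∪ T) + f (S ∩ T) ≤ f S + f T

  Approximates : ∀ {n} → Carrier → (Subset n → Carrier) → (Subset n → Carrier) → Set c
  Approximates ε F f = ∀ S → ((1# − ε) * f S ≤ F S) × (F S ≤ (1# + ε) * f S)

  marginal : ∀ {n} → (Subset n → Carrier) → Subset n → Fin n → Carrier
  marginal f S a = f (S ∪ ⁅ a ⁆) − f S

  curvTerm : ∀ {n} → (Subset n → Carrier) → Fin n → Carrier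
  curvTerm f a = 1# − marginal f (⊤ - a) a ÷ f ⁅ a ⁆

  -- κ is the curvature of f:  κ = 1 − min_a f_{N∖{a}}(a)/f({a}) = max_a curvTerm f a
  IsCurvature : ∀ {n} → (Subset n → Carrier) → Carrier → Set c
  IsCurvature f κ = (∃ λ a → κ ≡ curvTerm f a) × (∀ a → curvTerm f a ≤ κ)

  additive : ∀ {n} → (Subset n → Carrier) → Subset n → Carrier
  additive {ℕ.zero} F [] = 0#
  additive {ℕ.suc n} F (true ∷ S) = F ⁅ Fin.zero ⁆ + additive (λ T → F (false ∷ T)) S
  additive {ℕ.suc n} F (false ∷ S) = additive (λ T → F (false ∷ T)) S

{-# OPTIONS --safe #-}
-- Submodularity with f(∅) = 0 makes f subadditive, so f ≤ f_a.  Conversely, peeling the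
-- elements of S off one at a time writes f(S) as a sum of marginals f_{S'}(e) with
-- S' ⊆ N∖{e}; by diminishing returns each is at least f_{N∖{e}}(e) ≥ (1 − c) f({e}),
-- so (1 − c) f_a ≤ f.  As F and F_a are within factors 1 ± ε of f and f_a, both bounds follow.
module Submission where

open import Defs
open import Level using (Level)
open import Data.Nat using (ℕ; suc)
open import Data.Fin using (Fin; zero; suc)
open import Data.Fin.Subset using (Subset; ⁅_⁆; ⊤; ⊥; _∪_; _∩_; _─_; _-_; inside; outside)
open import Data.Fin.Subset.Properties
  using (∪-comm; ∪-assoc; ∪-idem; ∪-identityˡ; ∪-identityʳ; ∪-zeroʳ; ∩-comm; ∩-zeroˡ; ∩-abs-∪; p─⊥≡p; ⊥⊆)
open import Data.Vec using (_∷_; [])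
open import Data.Product using (_×_; _,_; proj₁; proj₂)
open import Data.Sum using (inj₁; inj₂)
open import Relation.Nullary using (¬_)
open import Relation.Binary.PropositionalEquality using (_≡_; _≢_; refl; sym; trans; cong; subst₂)
open import Relation.Binary.Bundles using (Poset)
open import Relation.Binary.Structures using (IsTotalOrder)
open import Algebra.Structures using (IsCommutativeRing)
open import Algebra.Bundles using (CommutativeRing)
import Algebra.Properties.Group as GroupProperties
import Algebra.Properties.Ring as RingProperties
import Algebra.Solver.CommutativeMonoid as CommutativeMonoidSolver
import Relation.Binary.Reasoning.PartialOrder as ≤-Reasoning

[p∪q]∪p≡p∪q : ∀ {n} (p q : Subset n) → (p ∪ q) ∪ p ≡ p ∪ q
[p∪q]∪p≡p∪q p q = trans (∪-comm (p ∪ q) p) (trans (sym (∪-assoc p p q)) (cong (_∪ q) (∪-idem p)))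

[p∪q]∩p≡p : ∀ {n} (p q : Subset n) → (p ∪ q) ∩ p ≡ p
[p∪q]∩p≡p p q = trans (∩-comm (p ∪ q) p) (∩-abs-∪ p q)

restrict : ∀ {a} {A : Set a} {n} → (Subset (suc n) → A) → Subset n → A
restrict f T = f (outside ∷ T)

module OrderedFieldProperties {ℓ : Level} (K : OrderedField ℓ) where
  open OrderedField K
  open IsCommutativeRing isCommutativeRing
    using (+-comm; +-identityˡ; +-identityʳ; -‿inverseʳ; *-assoc; *-comm; *-identityˡ; *-identityʳ)
  open IsTotalOrder isTotalOrder using (total; antisym; ≤-respˡ-≈; ≤-respʳ-≈) renaming (trans to ≤-trans)

  commutativeRing : CommutativeRing ℓ ℓ
  commutativeRing = record { isCommutativeRing = isCommutativeRing }

  open CommutativeRing commutativeRing using (+-group; ring; +-commutativeMonoid)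
  open CommutativeMonoidSolver +-commutativeMonoid using (solve; _⊕_; _⊜_)
  open GroupProperties +-group using (//-rightDividesˡ; //-rightDividesʳ; x∙y⁻¹≈ε⇒x≈y; ⁻¹-involutive)
  open RingProperties ring using (-‿distribˡ-*; -‿distribʳ-*; x[y-z]≈xy-xz)

  poset : Poset ℓ ℓ ℓ
  poset = record { isPartialOrder = IsTotalOrder.isPartialOrder isTotalOrder }

  open ≤-Reasoning poset

  +-monoʳ-≤ : ∀ z {x y} → x ≤ y → z + x ≤ z + y
  +-monoʳ-≤ z {x} {y} x≤y = subst₂ _≤_ (+-comm x z) (+-comm y z) (+-monoˡ-≤ z x≤y)

  +-mono-≤ : ∀ {x y u v} → x ≤ y → u ≤ v → x + u ≤ y + v
  +-mono-≤ {y = y} {u} x≤y u≤v = ≤-trans (+-monoˡ-≤ u x≤y) (+-monoʳ-≤ y u≤v)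

  ≤+⇒−≤ : ∀ {x y z} → x ≤ z + y → x − y ≤ z
  ≤+⇒−≤ {y = y} {z} x≤z+y = ≤-respʳ-≈ (//-rightDividesʳ y z) (+-monoˡ-≤ (- y) x≤z+y)

  −≤⇒≤+ : ∀ {x y z} → x − y ≤ z → x ≤ z + y
  −≤⇒≤+ {x} {y} x−y≤z = ≤-respˡ-≈ (//-rightDividesˡ y x) (+-monoˡ-≤ y x−y≤z)

  +≤⇒≤− : ∀ {x y z} → x + y ≤ z → x ≤ z − y
  +≤⇒≤− {x} {y} x+y≤z = ≤-respˡ-≈ (//-rightDividesʳ y x) (+-monoˡ-≤ (- y) x+y≤z)

  ≤−⇒+≤ : ∀ {x y z} → x ≤ z − y → x + y ≤ z
  ≤−⇒+≤ {y = y} {z} x≤z−y = ≤-respʳ-≈ (//-rightDividesˡ y z) (+-monoˡ-≤ y x≤z−y)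

  −≤⇒−≤ : ∀ {x y z} → x − y ≤ z → x − z ≤ y
  −≤⇒−≤ {y = y} {z} x−y≤z = ≤+⇒−≤ (≤-respʳ-≈ (+-comm z y) (−≤⇒≤+ x−y≤z))

  +≤+⇒−≤− : ∀ {a b c d} → a + d ≤ c + b → a − b ≤ c − d
  +≤+⇒−≤− {a} {b} {c} {d} a+d≤c+b = +≤⇒≤− (begin
    a − b + d ≡⟨ solve 3 (λ x y z → (x ⊕ y) ⊕ z ⊜ (x ⊕ z) ⊕ y) refl a (- b) d ⟩
    a + d − b ≤⟨ ≤+⇒−≤ a+d≤c+b ⟩
    c         ∎)

  x≤y⇒0≤y−x : ∀ {x y} → x ≤ y → 0# ≤ y − x
  x≤y⇒0≤y−x {x} x≤y = ≤-respˡ-≈ (-‿inverseʳ x) (+-monoˡ-≤ (- x) x≤y)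

  0≤y−x⇒x≤y : ∀ {x y} → 0# ≤ y − x → x ≤ y
  0≤y−x⇒x≤y {x} {y} 0≤y−x = subst₂ _≤_ (+-identityˡ x) (//-rightDividesˡ x y) (+-monoˡ-≤ x 0≤y−x)

  x<y⇒0<y−x : ∀ {x y} → x < y → 0# < y − x
  x<y⇒0<y−x {x} {y} (x≤y , x≢y) =
    x≤y⇒0≤y−x x≤y , λ 0≡y−x → x≢y (sym (x∙y⁻¹≈ε⇒x≈y y x (sym 0≡y−x)))

  0<x⇒x≢0 : ∀ {x} → 0# < x → x ≢ 0#
  0<x⇒x≢0 (_ , 0≢x) x≡0 = 0≢x (sym x≡0)

  0≤x*x : ∀ x → 0# ≤ x * x
  0≤x*x x with total 0# x
  ... | inj₁ 0≤x = *-nonneg 0≤x 0≤x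
  ... | inj₂ x≤0 = ≤-respʳ-≈ -x*-x≡x*x (*-nonneg 0≤-x 0≤-x)
    where
    0≤-x : 0# ≤ - x
    0≤-x = ≤-respʳ-≈ (+-identityˡ (- x)) (x≤y⇒0≤y−x x≤0)
    -x*-x≡x*x : - x * - x ≡ x * x
    -x*-x≡x*x = begin-equality
      - x * - x     ≡⟨ -‿distribˡ-* x (- x) ⟨
      - (x * - x)   ≡⟨ cong -_ (-‿distribʳ-* x x) ⟨
      - (- (x * x)) ≡⟨ ⁻¹-involutive (x * x) ⟩
      x * x         ∎

  0<1 : 0# < 1#
  0<1 = ≤-respʳ-≈ (*-identityˡ 1#) (0≤x*x 1#) , 0≢1

  0<1+x : ∀ {x} → 0# ≤ x → 0# < 1# + x
  0<1+x {x} 0≤x = ≤-trans 0≤1 1≤1+x , λ 0≡1+x → 0≢1 (antisym 0≤1 (≤-respʳ-≈ (sym 0≡1+x) 1≤1+x))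
    where
    0≤1 : 0# ≤ 1#
    0≤1 = proj₁ 0<1
    1≤1+x : 1# ≤ 1# + x
    1≤1+x = ≤-respˡ-≈ (+-identityʳ 1#) (+-monoʳ-≤ 1# 0≤x)

  *-monoˡ-≤-nonNeg : ∀ {c x y} → 0# ≤ c → x ≤ y → c * x ≤ c * y
  *-monoˡ-≤-nonNeg {c} {x} {y} 0≤c x≤y =
    0≤y−x⇒x≤y (≤-respʳ-≈ (x[y-z]≈xy-xz c y x) (*-nonneg 0≤c (x≤y⇒0≤y−x x≤y)))

  *-monoʳ-≤-nonNeg : ∀ {c x y} → 0# ≤ c → x ≤ y → x * c ≤ y * c
  *-monoʳ-≤-nonNeg {c} {x} {y} 0≤c x≤y =
    subst₂ _≤_ (*-comm c x) (*-comm c y) (*-monoˡ-≤-nonNeg 0≤c x≤y)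

  x⁻¹*x≡1 : ∀ {x} → x ≢ 0# → x ⁻¹ * x ≡ 1#
  x⁻¹*x≡1 {x} x≢0 = trans (*-comm (x ⁻¹) x) (inverseʳ x x≢0)

  x⁻¹*[x*y]≡y : ∀ {x} → x ≢ 0# → ∀ y → x ⁻¹ * (x * y) ≡ y
  x⁻¹*[x*y]≡y {x} x≢0 y = begin-equality
    x ⁻¹ * (x * y) ≡⟨ *-assoc (x ⁻¹) x y ⟨
    x ⁻¹ * x * y   ≡⟨ cong (_* y) (x⁻¹*x≡1 x≢0) ⟩
    1# * y         ≡⟨ *-identityˡ y ⟩
    y              ∎

  x÷y*y≡x : ∀ x {y} → y ≢ 0# → x ÷ y * y ≡ x
  x÷y*y≡x x {y} y≢0 = begin-equality
    x * y ⁻¹ * y   ≡⟨ *-assoc x (y ⁻¹) y ⟩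
    x * (y ⁻¹ * y) ≡⟨ cong (x *_) (x⁻¹*x≡1 y≢0) ⟩
    x * 1#         ≡⟨ *-identityʳ x ⟩
    x              ∎

  0<x⇒0≤x⁻¹ : ∀ {x} → 0# < x → 0# ≤ x ⁻¹
  0<x⇒0≤x⁻¹ {x} 0<x = ≤-respʳ-≈ x*[x⁻¹*x⁻¹]≡x⁻¹ (*-nonneg (proj₁ 0<x) (0≤x*x (x ⁻¹)))
    where
    x*[x⁻¹*x⁻¹]≡x⁻¹ : x * (x ⁻¹ * x ⁻¹) ≡ x ⁻¹
    x*[x⁻¹*x⁻¹]≡x⁻¹ = begin-equality
      x * (x ⁻¹ * x ⁻¹) ≡⟨ *-assoc x (x ⁻¹) (x ⁻¹) ⟨
      x * x ⁻¹ * x ⁻¹   ≡⟨ cong (_* x ⁻¹) (inverseʳ x (0<x⇒x≢0 0<x)) ⟩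
      1# * x ⁻¹         ≡⟨ *-identityˡ (x ⁻¹) ⟩
      x ⁻¹              ∎

  *≤⇒≤⁻¹* : ∀ {c x y} → 0# < c → c * x ≤ y → x ≤ c ⁻¹ * y
  *≤⇒≤⁻¹* {c} {x} 0<c cx≤y =
    ≤-respˡ-≈ (x⁻¹*[x*y]≡y (0<x⇒x≢0 0<c) x) (*-monoˡ-≤-nonNeg (0<x⇒0≤x⁻¹ 0<c) cx≤y)

  ≤*⇒⁻¹*≤ : ∀ {c x y} → 0# < c → y ≤ c * x → c ⁻¹ * y ≤ x
  ≤*⇒⁻¹*≤ {c} {x} 0<c y≤cx =
    ≤-respʳ-≈ (x⁻¹*[x*y]≡y (0<x⇒x≢0 0<c) x) (*-monoˡ-≤-nonNeg (0<x⇒0≤x⁻¹ 0<c) y≤cx)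

module SetFunctionProperties {ℓ : Level} (K : OrderedField ℓ) where
  open OrderedField K
  open OrderedFieldProperties K
  open IsCommutativeRing isCommutativeRing using (+-comm; +-identityʳ; *-assoc; distribˡ; zeroʳ)
  open CommutativeRing commutativeRing using (*-commutativeMonoid)
  open CommutativeMonoidSolver *-commutativeMonoid using (solve; _⊕_; _⊜_; id)
  open IsTotalOrder isTotalOrder using (≤-respˡ-≈; ≤-respʳ-≈)
    renaming (refl to ≤-refl; reflexive to ≤-reflexive; trans to ≤-trans)
  open ≤-Reasoning poset

  additive-mono : ∀ {n} {g h : Subset n → Carrier} → (∀ a → g ⁅ a ⁆ ≤ h ⁅ a ⁆) →
                  ∀ S → additive K g S ≤ additive K h S
  additive-mono g≤h [] = ≤-refl
  additive-mono {g = g} {h} g≤h (outside ∷ S) =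
    additive-mono {g = restrict g} {restrict h} (λ a → g≤h (suc a)) S
  additive-mono {g = g} {h} g≤h (inside ∷ S) =
    +-mono-≤ (g≤h zero) (additive-mono {g = restrict g} {restrict h} (λ a → g≤h (suc a)) S)

  *-distribˡ-additive : ∀ {n} c (g : Subset n → Carrier) S →
                        additive K (λ T → c * g T) S ≡ c * additive K g S
  *-distribˡ-additive c g [] = sym (zeroʳ c)
  *-distribˡ-additive c g (outside ∷ S) = *-distribˡ-additive c (restrict g) S
  *-distribˡ-additive c g (inside ∷ S) =
    trans (cong (c * g ⁅ zero ⁆ +_) (*-distribˡ-additive c (restrict g) S)) (sym (distribˡ c _ _))

  approximates⇒additive-bounds : ∀ {n ε} {F f : Subset n → Carrier} → Approximates K ε F f → ∀ S →
    ((1# − ε) * additive K f S ≤ additive K F S) × (additive K F S ≤ (1# + ε) * additive K f S)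
  approximates⇒additive-bounds {ε = ε} {F} {f} approx S =
    ≤-respˡ-≈ (*-distribˡ-additive (1# − ε) f S) (additive-mono (λ a → proj₁ (approx ⁅ a ⁆)) S) ,
    ≤-respʳ-≈ (*-distribˡ-additive (1# + ε) f S) (additive-mono (λ a → proj₂ (approx ⁅ a ⁆)) S)

  submodular-restrict : ∀ {n} {f : Subset (suc n) → Carrier} → Submodular K f → Submodular K (restrict f)
  submodular-restrict sub S T = sub (outside ∷ S) (outside ∷ T)

  submodular-square : ∀ {n} {f : Subset (suc n) → Carrier} → Submodular K f → ∀ Y Z →
    f (inside ∷ (Y ∪ Z)) + f (outside ∷ Y) ≤ f (outside ∷ (Y ∪ Z)) + f (inside ∷ Y)
  submodular-square {f = f} sub Y Z =
    subst₂ (λ U V → f (inside ∷ U) + f (outside ∷ V) ≤ f (outside ∷ (Y ∪ Z)) + f (inside ∷ Y))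
      ([p∪q]∪p≡p∪q Y Z) ([p∪q]∩p≡p Y Z) (sub (outside ∷ (Y ∪ Z)) (inside ∷ Y))

  submodular-disjoint : ∀ {n} {f : Subset n → Carrier} → Normalized K f → Submodular K f →
                        ∀ {A B} → A ∩ B ≡ ⊥ → f (A ∪ B) ≤ f A + f B
  submodular-disjoint {f = f} f∅ sub {A} {B} A∩B≡⊥ = begin
    f (A ∪ B)             ≡⟨ +-identityʳ (f (A ∪ B)) ⟨
    f (A ∪ B) + 0#        ≡⟨ cong (f (A ∪ B) +_) (trans (cong f A∩B≡⊥) f∅) ⟨
    f (A ∪ B) + f (A ∩ B) ≤⟨ sub A B ⟩
    f A + f B             ∎

  ≤-additive : ∀ {n} {f : Subset n → Carrier} → Normalized K f → Submodular K f →
               ∀ S → f S ≤ additive K f S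
  ≤-additive f∅ sub [] = ≤-reflexive f∅
  ≤-additive {f = f} f∅ sub (outside ∷ S) = ≤-additive {f = restrict f} f∅ (submodular-restrict sub) S
  ≤-additive {f = f} f∅ sub (inside ∷ S) = begin
    f (inside ∷ S)                         ≡⟨ cong (λ T → f (inside ∷ T)) (∪-identityˡ S) ⟨
    f (⁅ zero ⁆ ∪ (outside ∷ S))           ≤⟨ submodular-disjoint f∅ sub (cong (outside ∷_) (∩-zeroˡ S)) ⟩
    f ⁅ zero ⁆ + f (outside ∷ S)           ≤⟨ +-monoʳ-≤ (f ⁅ zero ⁆) (≤-additive {f = restrict f} f∅ (submodular-restrict sub) S) ⟩
    f ⁅ zero ⁆ + additive K (restrict f) S ∎

  top-marginal-zero≤ : ∀ {n} {f : Subset (suc n) → Carrier} → Submodular K f → ∀ S →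
                       marginal K f (⊤ - zero) zero ≤ f (inside ∷ S) − f (outside ∷ S)
  top-marginal-zero≤ {n} {f} sub S = ≤-respˡ-≈ (sym marginal-at-zero) (+≤+⇒−≤− square)
    where
    marginal-at-zero : marginal K f (⊤ - zero) zero ≡ f (inside ∷ ⊤) − f (outside ∷ ⊤)
    marginal-at-zero = begin-equality
      f (inside ∷ ((⊤ ─ ⊥) ∪ ⊥)) − f (outside ∷ (⊤ ─ ⊥)) ≡⟨ cong (λ X → f (inside ∷ (X ∪ ⊥)) − f (outside ∷ X)) (p─⊥≡p ⊤) ⟩
      f (inside ∷ (⊤ ∪ ⊥)) − f (outside ∷ ⊤)           ≡⟨ cong (λ X → f (inside ∷ X) − f (outside ∷ ⊤)) (∪-identityʳ ⊤) ⟩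
      f (inside ∷ ⊤) − f (outside ∷ ⊤)                 ∎
    square : f (inside ∷ ⊤) + f (outside ∷ S) ≤ f (inside ∷ S) + f (outside ∷ ⊤)
    square = begin
      f (inside ∷ ⊤) + f (outside ∷ S)        ≡⟨ cong (λ X → f (inside ∷ X) + f (outside ∷ S)) (∪-zeroʳ S) ⟨
      f (inside ∷ (S ∪ ⊤)) + f (outside ∷ S)  ≤⟨ submodular-square sub S ⊤ ⟩
      f (outside ∷ (S ∪ ⊤)) + f (inside ∷ S)  ≡⟨ cong (λ X → f (outside ∷ X) + f (inside ∷ S)) (∪-zeroʳ S) ⟩
      f (outside ∷ ⊤) + f (inside ∷ S)        ≡⟨ +-comm (f (outside ∷ ⊤)) (f (inside ∷ S)) ⟩
      f (inside ∷ S) + f (outside ∷ ⊤)        ∎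

  top-marginals-restrict : ∀ {n} {f g : Subset (suc n) → Carrier} → Submodular K f →
    (∀ a → g ⁅ a ⁆ ≤ marginal K f (⊤ - a) a) →
    ∀ a → restrict g ⁅ a ⁆ ≤ marginal K (restrict f) (⊤ - a) a
  top-marginals-restrict sub g≤ a = ≤-trans (g≤ (suc a)) (+≤+⇒−≤− (submodular-square sub (⊤ - a) ⁅ a ⁆))

  additive≤-from-top-marginals : ∀ {n} {f g : Subset n → Carrier} → Normalized K f → Submodular K f →
    (∀ a → g ⁅ a ⁆ ≤ marginal K f (⊤ - a) a) → ∀ S → additive K g S ≤ f S
  additive≤-from-top-marginals f∅ sub g≤ [] = ≤-reflexive (sym f∅)
  additive≤-from-top-marginals {f = f} {g} f∅ sub g≤ (outside ∷ S) =
    additive≤-from-top-marginals {f = restrict f} {restrict g} f∅ (submodular-restrict sub)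
      (top-marginals-restrict {g = g} sub g≤) S
  additive≤-from-top-marginals {f = f} {g} f∅ sub g≤ (inside ∷ S) = begin
    g ⁅ zero ⁆ + additive K (restrict g) S ≤⟨ +-monoʳ-≤ (g ⁅ zero ⁆) tail ⟩
    g ⁅ zero ⁆ + f (outside ∷ S)           ≤⟨ ≤−⇒+≤ (≤-trans (g≤ zero) (top-marginal-zero≤ sub S)) ⟩
    f (inside ∷ S)                         ∎
    where
    tail : additive K (restrict g) S ≤ f (outside ∷ S)
    tail = additive≤-from-top-marginals {f = restrict f} {restrict g} f∅ (submodular-restrict sub)
             (top-marginals-restrict {g = g} sub g≤) S

  top-marginal-lower-bound : ∀ {n} {f : Subset n → Carrier} {κ} → Normalized K f → Monotone K f →
    (∀ a → f ⁅ a ⁆ ≢ 0#) → (∀ a → curvTerm K f a ≤ κ) →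
    ∀ a → (1# − κ) * f ⁅ a ⁆ ≤ marginal K f (⊤ - a) a
  top-marginal-lower-bound {f = f} {κ} f∅ mono f⁅⁆≢0 curv≤κ a = begin
    (1# − κ) * f ⁅ a ⁆                     ≤⟨ *-monoʳ-≤-nonNeg 0≤f⁅a⁆ (−≤⇒−≤ (curv≤κ a)) ⟩
    marginal K f (⊤ - a) a ÷ f ⁅ a ⁆ * f ⁅ a ⁆ ≡⟨ x÷y*y≡x (marginal K f (⊤ - a) a) (f⁅⁆≢0 a) ⟩
    marginal K f (⊤ - a) a                 ∎
    where
    0≤f⁅a⁆ : 0# ≤ f ⁅ a ⁆
    0≤f⁅a⁆ = ≤-respˡ-≈ f∅ (mono ⊥ ⁅ a ⁆ ⊥⊆)

  curvature⇒additive≤ : ∀ {n} {f : Subset n → Carrier} {κ} → Normalized K f → Monotone K f → Submodular K f →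
    (∀ a → f ⁅ a ⁆ ≢ 0#) → (∀ a → curvTerm K f a ≤ κ) → κ < 1# →
    ∀ S → additive K f S ≤ (1# − κ) ⁻¹ * f S
  curvature⇒additive≤ {f = f} {κ} f∅ mono sub f⁅⁆≢0 curv≤κ κ<1 S =
    *≤⇒≤⁻¹* (x<y⇒0<y−x κ<1) (≤-respˡ-≈ (*-distribˡ-additive (1# − κ) f S)
      (additive≤-from-top-marginals f∅ sub (top-marginal-lower-bound f∅ mono f⁅⁆≢0 curv≤κ) S))

  approximation-lower-bound : ∀ {n ε} {f F : Subset n → Carrier} → 0# ≤ ε → ε < 1# →
    Normalized K f → Submodular K f → Approximates K ε F f →
    ∀ S → (1# − ε) ÷ (1# + ε) * F S ≤ additive K F S
  approximation-lower-bound {ε = ε} {f} {F} 0≤ε ε<1 f∅ sub approx S = begin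
    (1# − ε) * (1# + ε) ⁻¹ * F S   ≡⟨ *-assoc (1# − ε) ((1# + ε) ⁻¹) (F S) ⟩
    (1# − ε) * ((1# + ε) ⁻¹ * F S) ≤⟨ *-monoˡ-≤-nonNeg 0≤1−ε (≤*⇒⁻¹*≤ (0<1+x 0≤ε) (proj₂ (approx S))) ⟩
    (1# − ε) * f S                 ≤⟨ *-monoˡ-≤-nonNeg 0≤1−ε (≤-additive f∅ sub S) ⟩
    (1# − ε) * additive K f S      ≤⟨ proj₁ (approximates⇒additive-bounds approx S) ⟩
    additive K F S                 ∎
    where
    0≤1−ε : 0# ≤ 1# − ε
    0≤1−ε = proj₁ (x<y⇒0<y−x ε<1)

  approximation-upper-bound : ∀ {n ε κ} {f F : Subset n → Carrier} → 0# ≤ ε → ε < 1# →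
    Normalized K f → Monotone K f → Submodular K f → (∀ a → f ⁅ a ⁆ ≢ 0#) →
    (∀ a → curvTerm K f a ≤ κ) → κ < 1# → Approximates K ε F f →
    ∀ S → additive K F S ≤ 1# ÷ (1# − κ) * ((1# + ε) ÷ (1# − ε)) * F S
  approximation-upper-bound {ε = ε} {κ} {f} {F} 0≤ε ε<1 f∅ mono sub f⁅⁆≢0 curv≤κ κ<1 approx S = begin
    additive K F S                                    ≤⟨ proj₂ (approximates⇒additive-bounds approx S) ⟩
    (1# + ε) * additive K f S                         ≤⟨ *-monoˡ-≤-nonNeg 0≤1+ε additive≤f ⟩
    (1# + ε) * ((1# − κ) ⁻¹ * f S)                    ≤⟨ *-monoˡ-≤-nonNeg 0≤1+ε (*-monoˡ-≤-nonNeg 0≤[1−κ]⁻¹ f≤F) ⟩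
    (1# + ε) * ((1# − κ) ⁻¹ * ((1# − ε) ⁻¹ * F S))    ≡⟨ reassociate (1# + ε) ((1# − κ) ⁻¹) ((1# − ε) ⁻¹) (F S) ⟩
    1# * (1# − κ) ⁻¹ * ((1# + ε) * (1# − ε) ⁻¹) * F S ∎
    where
    0≤1+ε : 0# ≤ 1# + ε
    0≤1+ε = proj₁ (0<1+x 0≤ε)
    0≤[1−κ]⁻¹ : 0# ≤ (1# − κ) ⁻¹
    0≤[1−κ]⁻¹ = 0<x⇒0≤x⁻¹ (x<y⇒0<y−x κ<1)
    additive≤f : additive K f S ≤ (1# − κ) ⁻¹ * f S
    additive≤f = curvature⇒additive≤ f∅ mono sub f⁅⁆≢0 curv≤κ κ<1 S
    f≤F : f S ≤ (1# − ε) ⁻¹ * F S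
    f≤F = *≤⇒≤⁻¹* (x<y⇒0<y−x ε<1) (proj₁ (approx S))
    reassociate : ∀ a b c d → a * (b * (c * d)) ≡ 1# * b * (a * c) * d
    reassociate = solve 4 (λ a b c d → a ⊕ (b ⊕ (c ⊕ d)) ⊜ ((id ⊕ b) ⊕ (a ⊕ c)) ⊕ d) refl

lemma3 : ∀ {ℓ : Level} (K : OrderedField ℓ) →
    let open OrderedField K in
    ∀ {n : ℕ} (f F : Subset n → Carrier) (ε κ : Carrier) →
    0# ≤ ε → ε < 1# →
    Normalized K f → Monotone K f → Submodular K f →
    (∀ (a : Fin n) → ¬ (f ⁅ a ⁆ ≡ 0#)) →
    IsCurvature K f κ → κ < 1# →
    Approximates K ε F f →
    ∀ (S : Subset n) →
      ((1# − ε) ÷ (1# + ε) * F S ≤ additive K F S)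
      × (additive K F S ≤ 1# ÷ (1# − κ) * ((1# + ε) ÷ (1# − ε)) * F S)
lemma3 K f F ε κ 0≤ε ε<1 f∅ mono sub f⁅⁆≢0 (_ , curv≤κ) κ<1 approx S =
    approximation-lower-bound 0≤ε ε<1 f∅ sub approx S
  , approximation-upper-bound 0≤ε ε<1 f∅ mono sub f⁅⁆≢0 curv≤κ κ<1 approx S
  where open SetFunctionProperties K
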